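{- Let $b\ge2$. The matrices $U_1$ and $V_1$ have exactly the same set of eigenvalues, and this set consists of all roots of the polynomial equation \[ -1+r-r^2+\cdots+(-1)^{b+1}r^b=0. \]
   Context: $M_1$ is the $b\times b$ lower-bidiagonal matrix with all diagonal entries $1$, all entries directly below the diagonal equal to $-1$, and all other entries $0$; $T_1=M_1^t$ is its transpose. $S_1$ is the $b\times b$ lower-triangular matrix with all entries on and below the diagonal equal to $1$ and others $0$. $U_1=S_1T_1$ and $V_1=T_1S_1$. -}

module Defs where

open import Level using (Level; _⊔_) renaming (suc to lsuc)
open import Data.Nat using (ℕ; zero; suc)
open import Data.Fin using (Fin; toℕ)
open import Data.Nat.Base using (_≤ᵇ_; _≡ᵇ_)
open import Data.Bool using (Bool; true; false; if_then_else_)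
open import Data.Product using (Σ; ∃; _×_; _,_)
open import Relation.Nullary using (¬_)
open import Algebra.Bundles using (CommutativeRing)
import Algebra.Definitions.RawMonoid as RM

record Field (c ℓ : Level) : Set (lsuc (c ⊔ ℓ)) where
  field
    commutativeRing : CommutativeRing c ℓ
  open CommutativeRing commutativeRing public
  field
    0≉1     : ¬ (0# ≈ 1#)
    inverse : ∀ x → ¬ (x ≈ 0#) → ∃ λ y → x * y ≈ 1#

module FieldMatrices {c ℓ : Level} (F : Field c ℓ) where
  open Field F

  Matrix : ℕ → Set c
  Matrix b = Fin b → Fin b → Carrier

  Vector : ℕ → Set c
  Vector b = Fin b → Carrier

  ∑ : ∀ {n} → (Fin n → Carrier) → Carrier
  ∑ = RM.sum +-rawMonoid

  _⊗_ : ∀ {b} → Matrix b → Matrix b → Matrix b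
  (A ⊗ B) i j = ∑ (λ k → A i k * B k j)

  _·_ : ∀ {b} → Matrix b → Vector b → Vector b
  (A · v) i = ∑ (λ k → A i k * v k)

  transpose : ∀ {b} → Matrix b → Matrix b
  transpose A i j = A j i

  M₁ : ∀ {b} → Matrix b
  M₁ i j = if toℕ i ≡ᵇ toℕ j then 1#
           else (if toℕ i ≡ᵇ suc (toℕ j) then - 1# else 0#)

  T₁ : ∀ {b} → Matrix b
  T₁ = transpose M₁

  S₁ : ∀ {b} → Matrix b
  S₁ i j = if toℕ j ≤ᵇ toℕ i then 1# else 0#

  U₁ : ∀ {b} → Matrix b
  U₁ = S₁ ⊗ T₁

  V₁ : ∀ {b} → Matrix b
  V₁ = T₁ ⊗ S₁

  IsEigenvalue : ∀ {b} → Matrix b → Carrier → Set (c ⊔ ℓ)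
  IsEigenvalue {b} A λ′ =
    Σ (Vector b) λ v → (∃ λ i → ¬ (v i ≈ 0#)) × (∀ i → (A · v) i ≈ λ′ * v i)

  pow : Carrier → ℕ → Carrier
  pow x zero    = 1#
  pow x (suc n) = x * pow x n

  P : ℕ → Carrier → Carrier
  P b r = ∑ {suc b} (λ k → pow (- 1#) (suc (toℕ k)) * pow r (toℕ k))

{-# OPTIONS --safe #-}
module Submission where

-- Write w⁺ for w shifted up by one place, with a zero entering at the
-- bottom. Then T₁ w = w − w⁺ and S₁ takes partial sums, so the sums
-- telescope: U₁ v = v₀ − v⁺, while V₁ v is −v⁺ in every row but the last,
-- whose entry is ∑ v. An eigenvector of U₁ for r therefore satisfies
-- v_{j+1} = v₀ − r v_j, forcing v_j = v₀ σ_j with σ_j = 1 − r + ⋯ + (−r)^j,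
-- and its last row says v₀ σ_b = 0. An eigenvector of V₁ satisfies
-- v_{j+1} = −r v_j, forcing v_j = v₀ (−r)^j, and its last row again says
-- v₀ σ_b = 0. As v₀ ≠ 0, r is an eigenvalue of either matrix iff σ_b = 0,
-- and P_b(r) = −σ_b.

open import Defs
open import Level using (Level)
open import Data.Nat using (ℕ; zero; suc; s≤s; _≤_; _<ᵇ_; _≤ᵇ_)
open import Data.Product using (_×_; _,_; ∃)
open import Function.Bundles using (_⇔_; mk⇔)
open import Data.Fin.Base using (Fin; zero; suc; toℕ; inject₁; fromℕ)
open import Data.Fin.Properties using (toℕ-inject₁; toℕ-fromℕ)
open import Data.Fin.Induction using (<-weakInduction)
open import Data.Fin.Relation.Unary.Top using (view; ‵fromℕ; ‵inj₁)
open import Data.Vec.Functional using (tail)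
open import Data.Bool using (if_then_else_)
open import Function.Properties.Equivalence using () renaming (trans to ⇔-trans; sym to ⇔-sym)
open import Relation.Nullary using (¬_)
open import Relation.Binary.PropositionalEquality using (_≡_; cong) renaming (refl to ≡-refl)
import Algebra.Properties.Ring as RingProperties
import Algebra.Properties.CommutativeSemigroup as CommutativeSemigroupProperties
import Algebra.Properties.Monoid.Sum as MonoidSum
import Algebra.Properties.CommutativeMonoid.Sum as CommutativeMonoidSum
import Algebra.Properties.Semiring.Sum as SemiringSum
import Relation.Binary.Reasoning.Setoid as SetoidReasoning

module _ {c ℓ : Level} (F : Field c ℓ) where
  open Field F hiding (zero)
  open FieldMatrices F
  open RingProperties ring
    using (-1*x≈-x; -‿distribˡ-*; -‿distribʳ-*; -0#≈0#; -‿involutive; -‿+-comm;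
           x[y-z]≈xy-xz; +-inverseˡ-unique; x∙y⁻¹≈ε⇒x≈y; x≈y⇒x∙y⁻¹≈ε)
  open CommutativeSemigroupProperties *-commutativeSemigroup using (interchange; x∙yz≈y∙xz)
  open MonoidSum +-monoid using (sum-cong-≋; sum-replicate-zero; sum-init-last)
  open CommutativeMonoidSum +-commutativeMonoid using (∑-comm)
  open SemiringSum semiring using (*-distribˡ-sum; *-distribʳ-sum)
  open SetoidReasoning setoid

  x-0#≈x : ∀ x → x - 0# ≈ x
  x-0#≈x x = trans (+-congˡ -0#≈0#) (+-identityʳ x)

  x-[x+y]≈-y : ∀ x y → x - (x + y) ≈ - y
  x-[x+y]≈-y x y = begin
    x - (x + y)   ≈⟨ +-congˡ (sym (-‿+-comm x y)) ⟩
    x + (- x - y) ≈⟨ sym (+-assoc x (- x) (- y)) ⟩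
    (x - x) - y   ≈⟨ +-congʳ (-‿inverseʳ x) ⟩
    0# - y        ≈⟨ +-identityˡ (- y) ⟩
    - y           ∎

  x-[x-y]≈y : ∀ x y → x - (x - y) ≈ y
  x-[x-y]≈y x y = trans (x-[x+y]≈-y x (- y)) (-‿involutive y)

  [x-y]+[y-z]≈x-z : ∀ x y z → (x - y) + (y - z) ≈ x - z
  [x-y]+[y-z]≈x-z x y z = begin
    (x - y) + (y - z)   ≈⟨ +-assoc x (- y) (y - z) ⟩
    x + (- y + (y - z)) ≈⟨ +-congˡ (sym (+-assoc (- y) y (- z))) ⟩
    x + ((- y + y) - z) ≈⟨ +-congˡ (+-congʳ (-‿inverseˡ y)) ⟩
    x + (0# - z)        ≈⟨ +-congˡ (+-identityˡ (- z)) ⟩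
    x - z               ∎

  x-r[xy]≈x[1-ry] : ∀ r x y → x - r * (x * y) ≈ x * (1# - r * y)
  x-r[xy]≈x[1-ry] r x y = begin
    x - r * (x * y)      ≈⟨ +-cong (sym (*-identityʳ x)) (-‿cong (x∙yz≈y∙xz r x y)) ⟩
    x * 1# - x * (r * y) ≈⟨ sym (x[y-z]≈xy-xz x 1# (r * y)) ⟩
    x * (1# - r * y)     ∎

  -[r[xy]]≈x[-r*y] : ∀ r x y → - (r * (x * y)) ≈ x * (- r * y)
  -[r[xy]]≈x[-r*y] r x y = begin
    - (r * (x * y)) ≈⟨ -‿cong (x∙yz≈y∙xz r x y) ⟩
    - (x * (r * y)) ≈⟨ -‿distribʳ-* x (r * y) ⟩
    x * - (r * y)   ≈⟨ *-congˡ (-‿distribˡ-* r y) ⟩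
    x * (- r * y)   ∎

  -[-x*y]≈x*y : ∀ x y → - (- x * y) ≈ x * y
  -[-x*y]≈x*y x y = trans (-‿cong (sym (-‿distribˡ-* x y))) (-‿involutive (x * y))

  x≉0⇒xy≈0⇒y≈0 : ∀ {x y} → ¬ x ≈ 0# → x * y ≈ 0# → y ≈ 0#
  x≉0⇒xy≈0⇒y≈0 {x} {y} x≉0 xy≈0 with inverse x x≉0
  ... | x⁻¹ , xx⁻¹≈1 = begin
    y             ≈⟨ sym (*-identityˡ y) ⟩
    1# * y        ≈⟨ *-congʳ (sym xx⁻¹≈1) ⟩
    (x * x⁻¹) * y ≈⟨ *-congʳ (*-comm x x⁻¹) ⟩
    (x⁻¹ * x) * y ≈⟨ *-assoc x⁻¹ x y ⟩
    x⁻¹ * (x * y) ≈⟨ *-congˡ xy≈0 ⟩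
    x⁻¹ * 0#      ≈⟨ zeroʳ x⁻¹ ⟩
    0#            ∎

  ∑-zeroˡ : ∀ {m} (u : Vector m) → ∑ (λ k → 0# * u k) ≈ 0#
  ∑-zeroˡ {m} u = trans (sum-cong-≋ (λ k → zeroˡ (u k))) (sum-replicate-zero m)

  ∑-neg : ∀ {m} (f : Vector m) → ∑ (λ k → - f k) ≈ - ∑ f
  ∑-neg f = begin
    ∑ (λ k → - f k)      ≈⟨ sum-cong-≋ (λ k → sym (-1*x≈-x (f k))) ⟩
    ∑ (λ k → - 1# * f k) ≈⟨ sym (*-distribˡ-sum (- 1#) f) ⟩
    - 1# * ∑ f           ≈⟨ -1*x≈-x (∑ f) ⟩
    - ∑ f                ∎

  ·-congˡ : ∀ {b} (A : Matrix b) {v w : Vector b} → (∀ k → v k ≈ w k) → ∀ i → (A · v) i ≈ (A · w) i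
  ·-congˡ A v≈w i = sum-cong-≋ (λ k → *-congˡ (v≈w k))

  ⊗-· : ∀ {b} (A B : Matrix b) (v : Vector b) i → ((A ⊗ B) · v) i ≈ (A · (B · v)) i
  ⊗-· A B v i = begin
    ∑ (λ k → ∑ (λ l → A i l * B l k) * v k)   ≈⟨ sum-cong-≋ (λ k → *-distribʳ-sum (v k) (λ l → A i l * B l k)) ⟩
    ∑ (λ k → ∑ (λ l → A i l * B l k * v k))   ≈⟨ ∑-comm (λ k l → A i l * B l k * v k) ⟩
    ∑ (λ l → ∑ (λ k → A i l * B l k * v k))   ≈⟨ sum-cong-≋ (λ l → sum-cong-≋ (λ k → *-assoc (A i l) (B l k) (v k))) ⟩
    ∑ (λ l → ∑ (λ k → A i l * (B l k * v k))) ≈⟨ sum-cong-≋ (λ l → sym (*-distribˡ-sum (A i l) (λ k → B l k * v k))) ⟩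
    ∑ (λ l → A i l * ∑ (λ k → B l k * v k))   ∎

  ∀-inject₁∧fromℕ : ∀ {n p} (P : Fin (suc n) → Set p) → (∀ j → P (inject₁ j)) → P (fromℕ n) → ∀ i → P i
  ∀-inject₁∧fromℕ P P-inject₁ P-fromℕ i with view i
  ... | ‵fromℕ         = P-fromℕ
  ... | ‵inj₁ {i = j} _ = P-inject₁ j

  shift : ∀ {n} → Vector (suc n) → Vector (suc n)
  shift {zero}  w zero    = 0#
  shift {suc n} w zero    = w (suc zero)
  shift {suc n} w (suc i) = shift (tail w) i

  shift-inject₁ : ∀ {n} (w : Vector (suc n)) (j : Fin n) → shift w (inject₁ j) ≡ w (suc j)
  shift-inject₁ {suc n} w zero    = ≡-refl
  shift-inject₁ {suc n} w (suc j) = shift-inject₁ (tail w) j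

  shift-fromℕ : ∀ {n} (w : Vector (suc n)) → shift w (fromℕ n) ≡ 0#
  shift-fromℕ {zero}  w = ≡-refl
  shift-fromℕ {suc n} w = shift-fromℕ (tail w)

  T₁-· : ∀ {n} (w : Vector (suc n)) i → (T₁ · w) i ≈ w i - shift w i
  T₁-· {zero}  w zero    = trans (+-identityʳ _) (trans (*-identityˡ (w zero)) (sym (x-0#≈x (w zero))))
  T₁-· {suc n} w zero    = +-cong (*-identityˡ (w zero)) below-diagonal
    where
    below-diagonal : ∑ (λ k → M₁ (suc k) zero * w (suc k)) ≈ - w (suc zero)
    below-diagonal = begin
      - 1# * w (suc zero) + ∑ (λ k → 0# * w (suc (suc k))) ≈⟨ +-congˡ (∑-zeroˡ (tail (tail w))) ⟩
      - 1# * w (suc zero) + 0#                             ≈⟨ +-identityʳ _ ⟩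
      - 1# * w (suc zero)                                  ≈⟨ -1*x≈-x (w (suc zero)) ⟩
      - w (suc zero)                                       ∎
  T₁-· {suc n} w (suc i) = begin
    0# * w zero + (T₁ · tail w) i ≈⟨ +-congʳ (zeroˡ (w zero)) ⟩
    0# + (T₁ · tail w) i          ≈⟨ +-identityˡ _ ⟩
    (T₁ · tail w) i               ≈⟨ T₁-· (tail w) i ⟩
    w (suc i) - shift w (suc i)   ∎

  <ᵇ-suc≡≤ᵇ : ∀ m n → (m <ᵇ suc n) ≡ (m ≤ᵇ n)
  <ᵇ-suc≡≤ᵇ zero    n = ≡-refl
  <ᵇ-suc≡≤ᵇ (suc m) n = ≡-refl

  S₁-·-zero : ∀ {n} (w : Vector (suc n)) → (S₁ · w) zero ≈ w zero
  S₁-·-zero w = trans (+-cong (*-identityˡ (w zero)) (∑-zeroˡ (tail w))) (+-identityʳ (w zero))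

  S₁-·-suc : ∀ {n} (w : Vector (suc n)) (i : Fin n) → (S₁ · w) (suc i) ≈ w zero + (S₁ · tail w) i
  S₁-·-suc {n} w i = +-cong (*-identityˡ (w zero))
    (sum-cong-≋ {n} (λ k → *-congʳ (reflexive (cong (λ t → if t then 1# else 0#) (<ᵇ-suc≡≤ᵇ (toℕ k) (toℕ i))))))

  S₁-·-inject₁ : ∀ {n} (w : Vector (suc n)) (j : Fin n) → (S₁ · w) (suc j) ≈ (S₁ · w) (inject₁ j) + w (suc j)
  S₁-·-inject₁ {suc n} w zero    = trans (S₁-·-suc w zero) (+-cong (sym (S₁-·-zero w)) (S₁-·-zero (tail w)))
  S₁-·-inject₁ {suc n} w (suc j) = begin
    (S₁ · w) (suc (suc j))                                  ≈⟨ S₁-·-suc w (suc j) ⟩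
    w zero + (S₁ · tail w) (suc j)                          ≈⟨ +-congˡ (S₁-·-inject₁ (tail w) j) ⟩
    w zero + ((S₁ · tail w) (inject₁ j) + w (suc (suc j))) ≈⟨ sym (+-assoc _ _ _) ⟩
    (w zero + (S₁ · tail w) (inject₁ j)) + w (suc (suc j)) ≈⟨ +-congʳ (sym (S₁-·-suc w (inject₁ j))) ⟩
    (S₁ · w) (suc (inject₁ j)) + w (suc (suc j))            ∎

  S₁-·-fromℕ : ∀ {n} (w : Vector (suc n)) → (S₁ · w) (fromℕ n) ≈ ∑ w
  S₁-·-fromℕ {zero}  w = trans (S₁-·-zero w) (sym (+-identityʳ (w zero)))
  S₁-·-fromℕ {suc n} w = trans (S₁-·-suc w (fromℕ n)) (+-congˡ (S₁-·-fromℕ (tail w)))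

  S₁-·-telescope : ∀ {n} (w : Vector (suc n)) i → (S₁ · (λ k → w k - shift w k)) i ≈ w zero - shift w i
  S₁-·-telescope         w zero    = S₁-·-zero (λ k → w k - shift w k)
  S₁-·-telescope {suc n} w (suc i) = begin
    (S₁ · (λ k → w k - shift w k)) (suc i)                                   ≈⟨ S₁-·-suc (λ k → w k - shift w k) i ⟩
    (w zero - w (suc zero)) + (S₁ · (λ k → w (suc k) - shift w (suc k))) i ≈⟨ +-congˡ (S₁-·-telescope (tail w) i) ⟩
    (w zero - w (suc zero)) + (w (suc zero) - shift w (suc i))               ≈⟨ [x-y]+[y-z]≈x-z _ _ _ ⟩
    w zero - shift w (suc i)                                                 ∎

  U₁-· : ∀ {n} (v : Vector (suc n)) i → (U₁ · v) i ≈ v zero - shift v i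
  U₁-· v i = begin
    (U₁ · v) i                          ≈⟨ ⊗-· S₁ T₁ v i ⟩
    (S₁ · (T₁ · v)) i                   ≈⟨ ·-congˡ S₁ (T₁-· v) i ⟩
    (S₁ · (λ k → v k - shift v k)) i    ≈⟨ S₁-·-telescope v i ⟩
    v zero - shift v i                  ∎

  U₁-·-inject₁ : ∀ {n} (v : Vector (suc n)) (j : Fin n) → (U₁ · v) (inject₁ j) ≈ v zero - v (suc j)
  U₁-·-inject₁ v j = trans (U₁-· v (inject₁ j)) (+-congˡ (-‿cong (reflexive (shift-inject₁ v j))))

  U₁-·-fromℕ : ∀ {n} (v : Vector (suc n)) → (U₁ · v) (fromℕ n) ≈ v zero
  U₁-·-fromℕ v = trans (U₁-· v (fromℕ _)) (trans (+-congˡ (-‿cong (reflexive (shift-fromℕ v)))) (x-0#≈x (v zero)))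

  V₁-· : ∀ {n} (v : Vector (suc n)) i → (V₁ · v) i ≈ (S₁ · v) i - shift (S₁ · v) i
  V₁-· v i = trans (⊗-· T₁ S₁ v i) (T₁-· (S₁ · v) i)

  V₁-·-inject₁ : ∀ {n} (v : Vector (suc n)) (j : Fin n) → (V₁ · v) (inject₁ j) ≈ - v (suc j)
  V₁-·-inject₁ v j = begin
    (V₁ · v) (inject₁ j)                                          ≈⟨ V₁-· v (inject₁ j) ⟩
    (S₁ · v) (inject₁ j) - shift (S₁ · v) (inject₁ j)             ≈⟨ +-congˡ (-‿cong (reflexive (shift-inject₁ (S₁ · v) j))) ⟩
    (S₁ · v) (inject₁ j) - (S₁ · v) (suc j)                       ≈⟨ +-congˡ (-‿cong (S₁-·-inject₁ v j)) ⟩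
    (S₁ · v) (inject₁ j) - ((S₁ · v) (inject₁ j) + v (suc j))     ≈⟨ x-[x+y]≈-y _ _ ⟩
    - v (suc j)                                                   ∎

  V₁-·-fromℕ : ∀ {n} (v : Vector (suc n)) → (V₁ · v) (fromℕ n) ≈ ∑ v
  V₁-·-fromℕ {n} v = begin
    (V₁ · v) (fromℕ n)                            ≈⟨ V₁-· v (fromℕ n) ⟩
    (S₁ · v) (fromℕ n) - shift (S₁ · v) (fromℕ n) ≈⟨ +-congˡ (-‿cong (reflexive (shift-fromℕ (S₁ · v)))) ⟩
    (S₁ · v) (fromℕ n) - 0#                       ≈⟨ x-0#≈x _ ⟩
    (S₁ · v) (fromℕ n)                            ≈⟨ S₁-·-fromℕ v ⟩
    ∑ v                                           ∎

  multiple-of-head⇒head≉0 : ∀ {n} {v : Vector (suc n)} (g : Vector (suc n)) →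
    (∀ i → v i ≈ v zero * g i) → ∃ (λ i → ¬ v i ≈ 0#) → ¬ v zero ≈ 0#
  multiple-of-head⇒head≉0 g v≈v₀g (i , vᵢ≉0) v₀≈0 = vᵢ≉0 (trans (v≈v₀g i) (trans (*-congʳ v₀≈0) (zeroˡ (g i))))

  module _ (r : Carrier) where

    σ : ℕ → Carrier
    σ k = ∑ {suc k} (λ i → pow (- r) (toℕ i))

    σ-zero : σ 0 ≈ 1#
    σ-zero = +-identityʳ 1#

    σ-suc : ∀ k → σ (suc k) ≈ 1# - r * σ k
    σ-suc k = +-congˡ (begin
      ∑ {suc k} (λ i → - r * pow (- r) (toℕ i)) ≈⟨ sym (*-distribˡ-sum {suc k} (- r) (λ i → pow (- r) (toℕ i))) ⟩
      - r * σ k                                 ≈⟨ sym (-‿distribˡ-* r (σ k)) ⟩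
      - (r * σ k)                               ∎)

    σ-suc-last : ∀ k → σ (suc k) ≈ σ k + pow (- r) (suc k)
    σ-suc-last k = trans (sum-init-last {suc k} (λ i → pow (- r) (toℕ i)))
      (+-cong (sum-cong-≋ {suc k} (λ i → reflexive (cong (pow (- r)) (toℕ-inject₁ i))))
              (reflexive (cong (pow (- r)) (toℕ-fromℕ (suc k)))))

    sign-pow : ∀ k → pow (- 1#) (suc k) * pow r k ≈ - pow (- r) k
    sign-pow zero    = trans (*-identityʳ _) (*-identityʳ (- 1#))
    sign-pow (suc k) = begin
      (- 1# * pow (- 1#) (suc k)) * (r * pow r k) ≈⟨ interchange (- 1#) _ r _ ⟩
      (- 1# * r) * (pow (- 1#) (suc k) * pow r k) ≈⟨ *-cong (-1*x≈-x r) (sign-pow k) ⟩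
      - r * - pow (- r) k                         ≈⟨ sym (-‿distribʳ-* (- r) (pow (- r) k)) ⟩
      - pow (- r) (suc k)                         ∎

    P≈-σ : ∀ b → P b r ≈ - σ b
    P≈-σ b = trans (sum-cong-≋ {suc b} (λ k → sign-pow (toℕ k))) (∑-neg {suc b} (λ k → pow (- r) (toℕ k)))

    P≈0⇔σ≈0 : ∀ b → P b r ≈ 0# ⇔ σ b ≈ 0#
    P≈0⇔σ≈0 b = mk⇔
      (λ P≈0 → trans (sym (-‿involutive (σ b))) (trans (-‿cong (trans (sym (P≈-σ b)) P≈0)) -0#≈0#))
      (λ σ≈0 → trans (P≈-σ b) (trans (-‿cong σ≈0) -0#≈0#))

    U₁-eigenvector : ∀ {n} {v : Vector (suc n)} → (∀ i → (U₁ · v) i ≈ r * v i) →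
      ∀ i → v i ≈ v zero * σ (toℕ i)
    U₁-eigenvector {v = v} Uv≈rv = <-weakInduction (λ i → v i ≈ v zero * σ (toℕ i)) base step
      where
      base : v zero ≈ v zero * σ 0
      base = sym (trans (*-congˡ σ-zero) (*-identityʳ (v zero)))
      step : ∀ j → v (inject₁ j) ≈ v zero * σ (toℕ (inject₁ j)) → v (suc j) ≈ v zero * σ (suc (toℕ j))
      step j ih = begin
        v (suc j)                              ≈⟨ sym (x-[x-y]≈y (v zero) (v (suc j))) ⟩
        v zero - (v zero - v (suc j))          ≈⟨ +-congˡ (-‿cong (trans (sym (U₁-·-inject₁ v j)) (Uv≈rv (inject₁ j)))) ⟩
        v zero - r * v (inject₁ j)             ≈⟨ +-congˡ (-‿cong (*-congˡ (trans ih (*-congˡ (reflexive (cong σ (toℕ-inject₁ j))))))) ⟩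
        v zero - r * (v zero * σ (toℕ j))      ≈⟨ x-r[xy]≈x[1-ry] r (v zero) (σ (toℕ j)) ⟩
        v zero * (1# - r * σ (toℕ j))          ≈⟨ *-congˡ (sym (σ-suc (toℕ j))) ⟩
        v zero * σ (suc (toℕ j))               ∎

    U₁-eigenvalue⇒σ≈0 : ∀ {n} → IsEigenvalue {suc n} U₁ r → σ (suc n) ≈ 0#
    U₁-eigenvalue⇒σ≈0 {n} (v , v≉0 , Uv≈rv) = x≉0⇒xy≈0⇒y≈0 v₀≉0 (begin
      v zero * σ (suc n)               ≈⟨ *-congˡ (σ-suc n) ⟩
      v zero * (1# - r * σ n)          ≈⟨ sym (x-r[xy]≈x[1-ry] r (v zero) (σ n)) ⟩
      v zero - r * (v zero * σ n)      ≈⟨ x≈y⇒x∙y⁻¹≈ε last-row ⟩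
      0#                               ∎)
      where
      v≈v₀σ : ∀ i → v i ≈ v zero * σ (toℕ i)
      v≈v₀σ = U₁-eigenvector Uv≈rv
      v₀≉0 : ¬ v zero ≈ 0#
      v₀≉0 = multiple-of-head⇒head≉0 (λ i → σ (toℕ i)) v≈v₀σ v≉0
      last-row : v zero ≈ r * (v zero * σ n)
      last-row = begin
        v zero               ≈⟨ sym (U₁-·-fromℕ v) ⟩
        (U₁ · v) (fromℕ n)   ≈⟨ Uv≈rv (fromℕ n) ⟩
        r * v (fromℕ n)      ≈⟨ *-congˡ (trans (v≈v₀σ (fromℕ n)) (*-congˡ (reflexive (cong σ (toℕ-fromℕ n))))) ⟩
        r * (v zero * σ n)   ∎

    σ≈0⇒U₁-eigenvalue : ∀ {n} → σ (suc n) ≈ 0# → IsEigenvalue {suc n} U₁ r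
    σ≈0⇒U₁-eigenvalue {n} σ≈0 = v , (zero , λ v₀≈0 → 0≉1 (trans (sym v₀≈0) σ-zero)) ,
                                  ∀-inject₁∧fromℕ (λ i → (U₁ · v) i ≈ r * v i) inner-row last-row
      where
      v : Vector (suc n)
      v i = σ (toℕ i)
      inner-row : ∀ j → (U₁ · v) (inject₁ j) ≈ r * v (inject₁ j)
      inner-row j = begin
        (U₁ · v) (inject₁ j)           ≈⟨ U₁-·-inject₁ v j ⟩
        σ 0 - σ (suc (toℕ j))          ≈⟨ +-cong σ-zero (-‿cong (σ-suc (toℕ j))) ⟩
        1# - (1# - r * σ (toℕ j))      ≈⟨ x-[x-y]≈y 1# _ ⟩
        r * σ (toℕ j)                  ≈⟨ *-congˡ (reflexive (cong σ (toℕ-inject₁ j))) ⟨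
        r * v (inject₁ j)              ∎
      last-row : (U₁ · v) (fromℕ n) ≈ r * v (fromℕ n)
      last-row = begin
        (U₁ · v) (fromℕ n) ≈⟨ U₁-·-fromℕ v ⟩
        σ 0                ≈⟨ σ-zero ⟩
        1#                 ≈⟨ x∙y⁻¹≈ε⇒x≈y 1# (r * σ n) (trans (sym (σ-suc n)) σ≈0) ⟩
        r * σ n            ≈⟨ *-congˡ (reflexive (cong σ (toℕ-fromℕ n))) ⟨
        r * v (fromℕ n)    ∎

    U₁-eigenvalue⇔σ≈0 : ∀ {n} → IsEigenvalue {suc n} U₁ r ⇔ σ (suc n) ≈ 0#
    U₁-eigenvalue⇔σ≈0 = mk⇔ U₁-eigenvalue⇒σ≈0 σ≈0⇒U₁-eigenvalue

    V₁-eigenvector : ∀ {n} {v : Vector (suc n)} → (∀ i → (V₁ · v) i ≈ r * v i) →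
      ∀ i → v i ≈ v zero * pow (- r) (toℕ i)
    V₁-eigenvector {v = v} Vv≈rv = <-weakInduction (λ i → v i ≈ v zero * pow (- r) (toℕ i)) base step
      where
      base : v zero ≈ v zero * 1#
      base = sym (*-identityʳ (v zero))
      step : ∀ j → v (inject₁ j) ≈ v zero * pow (- r) (toℕ (inject₁ j)) →
             v (suc j) ≈ v zero * pow (- r) (suc (toℕ j))
      step j ih = begin
        v (suc j)                             ≈⟨ sym (-‿involutive (v (suc j))) ⟩
        - - v (suc j)                         ≈⟨ -‿cong (trans (sym (V₁-·-inject₁ v j)) (Vv≈rv (inject₁ j))) ⟩
        - (r * v (inject₁ j))                 ≈⟨ -‿cong (*-congˡ (trans ih (*-congˡ (reflexive (cong (pow (- r)) (toℕ-inject₁ j)))))) ⟩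
        - (r * (v zero * pow (- r) (toℕ j)))  ≈⟨ -[r[xy]]≈x[-r*y] r (v zero) _ ⟩
        v zero * pow (- r) (suc (toℕ j))      ∎

    V₁-eigenvalue⇒σ≈0 : ∀ {n} → IsEigenvalue {suc n} V₁ r → σ (suc n) ≈ 0#
    V₁-eigenvalue⇒σ≈0 {n} (v , v≉0 , Vv≈rv) = x≉0⇒xy≈0⇒y≈0 v₀≉0 (begin
      v zero * σ (suc n)                              ≈⟨ *-congˡ (σ-suc-last n) ⟩
      v zero * (σ n + pow (- r) (suc n))              ≈⟨ distribˡ (v zero) (σ n) _ ⟩
      v zero * σ n + v zero * pow (- r) (suc n)       ≈⟨ +-congˡ (sym (-[r[xy]]≈x[-r*y] r (v zero) _)) ⟩
      v zero * σ n - r * (v zero * pow (- r) n)       ≈⟨ x≈y⇒x∙y⁻¹≈ε last-row ⟩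
      0#                                              ∎)
      where
      v≈v₀g : ∀ i → v i ≈ v zero * pow (- r) (toℕ i)
      v≈v₀g = V₁-eigenvector Vv≈rv
      v₀≉0 : ¬ v zero ≈ 0#
      v₀≉0 = multiple-of-head⇒head≉0 (λ i → pow (- r) (toℕ i)) v≈v₀g v≉0
      last-row : v zero * σ n ≈ r * (v zero * pow (- r) n)
      last-row = begin
        v zero * σ n                                 ≈⟨ *-distribˡ-sum {suc n} (v zero) (λ i → pow (- r) (toℕ i)) ⟩
        ∑ {suc n} (λ i → v zero * pow (- r) (toℕ i)) ≈⟨ sum-cong-≋ {suc n} (λ i → sym (v≈v₀g i)) ⟩
        ∑ v                                          ≈⟨ sym (V₁-·-fromℕ v) ⟩
        (V₁ · v) (fromℕ n)                           ≈⟨ Vv≈rv (fromℕ n) ⟩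
        r * v (fromℕ n)                              ≈⟨ *-congˡ (trans (v≈v₀g (fromℕ n)) (*-congˡ (reflexive (cong (pow (- r)) (toℕ-fromℕ n))))) ⟩
        r * (v zero * pow (- r) n)                   ∎

    σ≈0⇒V₁-eigenvalue : ∀ {n} → σ (suc n) ≈ 0# → IsEigenvalue {suc n} V₁ r
    σ≈0⇒V₁-eigenvalue {n} σ≈0 = v , (zero , λ v₀≈0 → 0≉1 (sym v₀≈0)) ,
                                  ∀-inject₁∧fromℕ (λ i → (V₁ · v) i ≈ r * v i) inner-row last-row
      where
      v : Vector (suc n)
      v i = pow (- r) (toℕ i)
      inner-row : ∀ j → (V₁ · v) (inject₁ j) ≈ r * v (inject₁ j)
      inner-row j = begin
        (V₁ · v) (inject₁ j)         ≈⟨ V₁-·-inject₁ v j ⟩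
        - (- r * pow (- r) (toℕ j))  ≈⟨ -[-x*y]≈x*y r _ ⟩
        r * pow (- r) (toℕ j)        ≈⟨ *-congˡ (reflexive (cong (pow (- r)) (toℕ-inject₁ j))) ⟨
        r * v (inject₁ j)            ∎
      last-row : (V₁ · v) (fromℕ n) ≈ r * v (fromℕ n)
      last-row = begin
        (V₁ · v) (fromℕ n)           ≈⟨ V₁-·-fromℕ v ⟩
        σ n                          ≈⟨ +-inverseˡ-unique (σ n) _ (trans (sym (σ-suc-last n)) σ≈0) ⟩
        - (- r * pow (- r) n)        ≈⟨ -[-x*y]≈x*y r _ ⟩
        r * pow (- r) n              ≈⟨ *-congˡ (reflexive (cong (pow (- r)) (toℕ-fromℕ n))) ⟨
        r * v (fromℕ n)              ∎

    V₁-eigenvalue⇔σ≈0 : ∀ {n} → IsEigenvalue {suc n} V₁ r ⇔ σ (suc n) ≈ 0#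
    V₁-eigenvalue⇔σ≈0 = mk⇔ V₁-eigenvalue⇒σ≈0 σ≈0⇒V₁-eigenvalue

lemma4p2 : {c ℓ : Level} (F : Field c ℓ) (b : ℕ) → 2 ≤ b →
    (r : Field.Carrier F) →
      (FieldMatrices.IsEigenvalue F {b} (FieldMatrices.U₁ F) r ⇔ FieldMatrices.IsEigenvalue F {b} (FieldMatrices.V₁ F) r) ×
      (FieldMatrices.IsEigenvalue F {b} (FieldMatrices.U₁ F) r ⇔ Field._≈_ F (FieldMatrices.P F b r) (Field.0# F))
lemma4p2 F (suc n) (s≤s _) r =
  ⇔-trans (U₁-eigenvalue⇔σ≈0 F r) (⇔-sym (V₁-eigenvalue⇔σ≈0 F r)) ,
  ⇔-trans (U₁-eigenvalue⇔σ≈0 F r) (⇔-sym (P≈0⇔σ≈0 F r (suc n)))
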